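{- Let $\Gamma$ be a countably infinite amenable group, $S\subseteq\Gamma$ a generating set, and $G\coloneqq\mathrm{Cay}(\Gamma,S)$. Then $\Gamma$ admits a Følner sequence $(\Phi_n)_{n=0}^\infty$ such that: each $G|\Phi_n$ is connected; $\mathbf{1}\in\Phi_0\subset\Phi_1\subset\cdots$, where $\mathbf{1}$ is the identity of $\Gamma$; $\bigcup_n\Phi_n=\Gamma$; and $\lim_{n\to\infty}|\Phi_n|/\log_2 n=\infty$.
   Context: A Følner sequence is a sequence of nonempty finite sets $\Phi_n\subseteq\Gamma$ with $\lim_n|\gamma\Phi_n\triangle\Phi_n|/|\Phi_n|=0$ for every $\gamma\in\Gamma$. $\mathrm{Cay}(\Gamma,S)$ is the graph on $\Gamma$ in which $\delta$ and $\gamma\delta$ are adjacent whenever $\gamma\in S\cup S^{ -1}$ and $\gamma\delta\ne\delta$; $G|\Phi=G\cap\Phi^2$. -}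

module Defs where

open import Data.Nat using (ℕ; zero; suc; _+_; _*_; _^_; _≤_; _≟_)
open import Data.Nat.Properties using ()
open import Data.List using (List; map; filter; length)
open import Data.List.Membership.Propositional using (_∈_; _∉_)
open import Data.List.Membership.DecPropositional _≟_ using (_∈?_)
open import Data.List.Relation.Unary.Unique.Propositional using (Unique)
open import Data.Product using (Σ; ∃; _×_; _,_)
open import Data.Sum using (_⊎_)
open import Relation.Binary.PropositionalEquality using (_≡_; _≢_)
open import Relation.Nullary.Decidable using (¬?)
open import Algebra.Structures using (IsGroup)

-- A countably infinite group, presented (up to isomorphism) with carrier ℕ.
record CountableGroup : Set where
  field
    _∙_     : ℕ → ℕ → ℕ
    ε       : ℕ
    _⁻¹     : ℕ → ℕ
    isGroup : IsGroup _≡_ _∙_ ε _⁻¹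

open CountableGroup public

-- Finite subsets of Γ : duplicate-free lists; |Φ| = length Φ.
FinSet : Set
FinSet = List ℕ

translate : CountableGroup → ℕ → FinSet → FinSet
translate Γ γ Φ = map (λ x → _∙_ Γ γ x) Φ

diff : FinSet → FinSet → FinSet
diff A B = filter (λ x → ¬? (x ∈? B)) A

symDiffCard : CountableGroup → ℕ → FinSet → ℕ
symDiffCard Γ γ Φ = length (diff (translate Γ γ Φ) Φ) + length (diff Φ (translate Γ γ Φ))

NonEmpty : FinSet → Set
NonEmpty Φ = ∃ λ x → x ∈ Φ

-- Følner sequence: nonempty finite sets Φ n with |γΦ_n △ Φ_n| / |Φ_n| → 0 for every γ.
-- The limit is written out: for every k, eventually (k+1)·|γΦ_n △ Φ_n| ≤ |Φ_n|.
IsFolner : CountableGroup → (ℕ → FinSet) → Set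
IsFolner Γ Φ =
  ((n : ℕ) → Unique (Φ n) × NonEmpty (Φ n)) ×
  ((γ k : ℕ) → ∃ λ N → (n : ℕ) → N ≤ n →
      suc k * symDiffCard Γ γ (Φ n) ≤ length (Φ n))

Amenable : CountableGroup → Set
Amenable Γ = ∃ λ Φ → IsFolner Γ Φ

data Generated (Γ : CountableGroup) (S : ℕ → Set) : ℕ → Set where
  gen-ε   : Generated Γ S (ε Γ)
  gen-s   : ∀ {s x} → S s → Generated Γ S x → Generated Γ S (_∙_ Γ s x)
  gen-inv : ∀ {s x} → S s → Generated Γ S x → Generated Γ S (_∙_ Γ (_⁻¹ Γ s) x)

Generates : CountableGroup → (ℕ → Set) → Set
Generates Γ S = (x : ℕ) → Generated Γ S x

CayAdj : CountableGroup → (ℕ → Set) → ℕ → ℕ → Set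
CayAdj Γ S δ δ' =
  ∃ λ γ → (S γ ⊎ S (_⁻¹ Γ γ)) × (δ' ≡ _∙_ Γ γ δ) × (δ' ≢ δ)

data PathIn (Γ : CountableGroup) (S : ℕ → Set) (Φ : FinSet) : ℕ → ℕ → Set where
  here : ∀ {x} → x ∈ Φ → PathIn Γ S Φ x x
  step : ∀ {x y z} → x ∈ Φ → CayAdj Γ S x y → PathIn Γ S Φ y z → PathIn Γ S Φ x z

InducedConnected : CountableGroup → (ℕ → Set) → FinSet → Set
InducedConnected Γ S Φ = ∀ {x y} → x ∈ Φ → y ∈ Φ → PathIn Γ S Φ x y

_⊂_ : FinSet → FinSet → Set
A ⊂ B = (∀ {x} → x ∈ A → x ∈ B) × (∃ λ x → x ∈ B × x ∉ A)

-- |Φ_n| / log₂ n → ∞ : for every M, eventually |Φ_n| ≥ M·log₂ n, i.e. n^M ≤ 2^|Φ_n|.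
GrowsFasterThanLog : (ℕ → FinSet) → Set
GrowsFasterThanLog Φ =
  (M : ℕ) → ∃ λ N → (n : ℕ) → N ≤ n → n ^ M ≤ 2 ^ length (Φ n)

module Submission where

-- Fix a finite T ⊆ Γ and the finite symmetric set G of letters of words for the elements of T
-- and their inverses. A Følner set F with |F| ≥ R · ∂_G F (∂_G the total G-boundary) splits into
-- its G-components; the boundary is additive over them, so some component C again satisfies
-- |C| ≥ R · ∂_G C, and since |γC △ C| ≤ ∂_G C for γ ∈ T it is almost invariant under T.
-- C is connected in the Cayley graph, and a right translate of it contains 1 without changing any
-- |γC △ C|. Enumerating Γ as ℕ, the sequence is Ψ₀ = {1} and Ψₙ₊₁ = Ψₙ ∪ (a path from 1 to n) ∪ Cₙ,
-- with Cₙ so large that the first two pieces hardly change the Følner ratios, that it contains a new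
-- point, and that |Ψₙ₊₁| ≥ (n+1)², which beats log₂ n.


open import Defs
open import Algebra.Bundles using (Group)
import Algebra.Properties.Group as GroupProperties
open import Data.Empty using (⊥-elim)
open import Data.List using (List; []; _∷_; map; filter; length; _++_; upTo)
open import Data.List.Membership.Propositional using (_∈_; _∉_; find; lose)
open import Data.List.Membership.Propositional.Properties
  using (∈-length; ∈-map⁺; ∈-map⁻; ∈-filter⁺; ∈-filter⁻; ∈-++⁺ˡ; ∈-++⁺ʳ; ∈-++⁻; ∈-upTo⁺; ∈-upTo⁻)
open import Data.List.Properties using (map-++; length-filter; filter-notAll; filter-some; length-map; filter-++; length-++; length-upTo)
open import Data.List.Relation.Binary.Subset.Propositional using (_⊆_)
open import Data.List.Relation.Unary.All as All using ([])
open import Data.List.Relation.Unary.AllPairs using ([]; _∷_)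
open import Data.List.Relation.Unary.Any as Any using (here; there; any?)
open import Data.List.Relation.Unary.Unique.Propositional using (Unique)
import Data.List.Relation.Unary.Unique.Propositional.Properties as Unique
open import Data.Nat using (ℕ; zero; suc; _+_; _*_; _^_; _≤_; _<_; _≟_; z≤n; s≤s; _⊔_)
open import Data.List.Membership.DecPropositional _≟_ using (_∈?_)
open import Data.Nat.ListAction using (sum)
open import Data.Nat.ListAction.Properties using (sum-++)
open import Data.Nat.Properties
open import Algebra.Properties.CommutativeSemigroup +-commutativeSemigroup
  using () renaming (interchange to +-interchange)
open import Data.Nat.Tactic.RingSolver using (solve-∀)
open import Data.Product using (∃; _×_; _,_; proj₁; proj₂)
open import Data.Sum using (_⊎_; inj₁; inj₂)
open import Function using (_∘_)
open import Level using (0ℓ)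
open import Relation.Binary.PropositionalEquality
open import Relation.Nullary using (¬_; Dec; yes; no; contradiction)
open import Relation.Nullary.Decidable using (¬?; _×-dec_)
open import Relation.Unary using (Pred; Decidable)

module _ {p} {P : Pred ℕ p} (P? : Decidable P) where

  length-filter+length-filter-¬ : ∀ xs → length (filter P? xs) + length (filter (¬? ∘ P?) xs) ≡ length xs
  length-filter+length-filter-¬ [] = refl
  length-filter+length-filter-¬ (x ∷ xs) with P? x
  ... | yes _ = cong suc (length-filter+length-filter-¬ xs)
  ... | no _ = trans (+-suc _ _) (cong suc (length-filter+length-filter-¬ xs))

  length-filter-map : ∀ (f : ℕ → ℕ) xs → length (filter P? (map f xs)) ≡ length (filter (P? ∘ f) xs)
  length-filter-map f [] = refl
  length-filter-map f (x ∷ xs) with P? (f x)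
  ... | yes _ = cong suc (length-filter-map f xs)
  ... | no _ = length-filter-map f xs

  length-filter≡0⇒¬ : ∀ {xs} → length (filter P? xs) ≡ 0 → ∀ {x} → x ∈ xs → ¬ P x
  length-filter≡0⇒¬ eq x∈xs px = <⇒≢ (filter-some P? (Any.map (λ { refl → px }) x∈xs)) (sym eq)

  ¬⇒length-filter≡0 : ∀ xs → (∀ {x} → x ∈ xs → ¬ P x) → length (filter P? xs) ≡ 0
  ¬⇒length-filter≡0 [] _ = refl
  ¬⇒length-filter≡0 (x ∷ xs) ¬P with P? x
  ... | yes px = ⊥-elim (¬P (here refl) px)
  ... | no _ = ¬⇒length-filter≡0 xs (¬P ∘ there)

length-filter-mono : ∀ {p q} {P : Pred ℕ p} {Q : Pred ℕ q} (P? : Decidable P) (Q? : Decidable Q) xs →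
  (∀ {x} → x ∈ xs → P x → Q x) → length (filter P? xs) ≤ length (filter Q? xs)
length-filter-mono P? Q? [] _ = z≤n
length-filter-mono P? Q? (x ∷ xs) P⇒Q with P? x | Q? x
... | yes _ | yes _ = s≤s (length-filter-mono P? Q? xs (P⇒Q ∘ there))
... | yes p | no ¬q = ⊥-elim (¬q (P⇒Q (here refl) p))
... | no _ | yes _ = m≤n⇒m≤1+n (length-filter-mono P? Q? xs (P⇒Q ∘ there))
... | no _ | no _ = length-filter-mono P? Q? xs (P⇒Q ∘ there)

length-filter-cong : ∀ {p q} {P : Pred ℕ p} {Q : Pred ℕ q} (P? : Decidable P) (Q? : Decidable Q) xs →
  (∀ {x} → x ∈ xs → P x → Q x) → (∀ {x} → x ∈ xs → Q x → P x) →
  length (filter P? xs) ≡ length (filter Q? xs)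
length-filter-cong P? Q? xs P⇒Q Q⇒P = ≤-antisym (length-filter-mono P? Q? xs P⇒Q) (length-filter-mono Q? P? xs Q⇒P)

length-filter-split : ∀ {p q} {P : Pred ℕ p} {Q : Pred ℕ q} (P? : Decidable P) (Q? : Decidable Q) xs →
  length (filter P? xs) ≡ length (filter P? (filter Q? xs)) + length (filter P? (filter (¬? ∘ Q?) xs))
length-filter-split P? Q? [] = refl
length-filter-split P? Q? (x ∷ xs) with Q? x
... | yes _ with P? x
...   | yes _ = cong suc (length-filter-split P? Q? xs)
...   | no _ = length-filter-split P? Q? xs
length-filter-split P? Q? (x ∷ xs) | no _ with P? x
...   | yes _ = trans (cong suc (length-filter-split P? Q? xs)) (sym (+-suc _ _))
...   | no _ = length-filter-split P? Q? xs

unique-⊆⇒length≤ : ∀ {xs ys : List ℕ} → Unique xs → xs ⊆ ys → length xs ≤ length ys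
unique-⊆⇒length≤ {[]} _ _ = z≤n
unique-⊆⇒length≤ {x ∷ xs} {ys} (x∉xs ∷ xs!) xs⊆ys = begin-strict
  length xs          ≤⟨ unique-⊆⇒length≤ xs! xs⊆ys-x ⟩
  length ys-x        <⟨ filter-notAll ≢x? ys (Any.map (λ { refl x≢x → x≢x refl }) (xs⊆ys (here refl))) ⟩
  length ys          ∎
  where
  open ≤-Reasoning
  ≢x? = λ y → ¬? (y ≟ x)
  ys-x = filter ≢x? ys
  xs⊆ys-x : xs ⊆ ys-x
  xs⊆ys-x z∈xs = ∈-filter⁺ ≢x? (xs⊆ys (there z∈xs)) (λ { refl → All.lookup x∉xs z∈xs refl })

unique-length<⇒∃∉ : ∀ {xs ys : List ℕ} → Unique ys → length xs < length ys → ∃ λ y → y ∈ ys × y ∉ xs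
unique-length<⇒∃∉ {xs} {ys} ys! xs<ys with any? (λ y → ¬? (y ∈? xs)) ys
... | yes some∉ = find some∉
... | no none∉ = contradiction (unique-⊆⇒length≤ ys! ys⊆xs) (<⇒≱ xs<ys)
  where
  ys⊆xs : ys ⊆ xs
  ys⊆xs {y} y∈ys with y ∈? xs
  ... | yes y∈xs = y∈xs
  ... | no y∉xs = ⊥-elim (none∉ (Any.map (λ { refl → y∉xs }) y∈ys))

length-filter-⊆⊇ : ∀ {p} {P : Pred ℕ p} (P? : Decidable P) {xs ys} → Unique xs → Unique ys →
  xs ⊆ ys → ys ⊆ xs → length (filter P? xs) ≡ length (filter P? ys)
length-filter-⊆⊇ P? {xs} {ys} xs! ys! xs⊆ys ys⊆xs =
  ≤-antisym (unique-⊆⇒length≤ (Unique.filter⁺ P? xs!) (filter-⊆ xs⊆ys))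
            (unique-⊆⇒length≤ (Unique.filter⁺ P? ys!) (filter-⊆ ys⊆xs))
  where
  filter-⊆ : ∀ {as bs} → as ⊆ bs → filter P? as ⊆ filter P? bs
  filter-⊆ {as} as⊆bs m = let (a∈ , pa) = ∈-filter⁻ P? {xs = as} m in ∈-filter⁺ P? (as⊆bs a∈) pa

infixl 6 _∪_
_∪_ : FinSet → FinSet → FinSet
A ∪ B = A ++ filter (λ x → ¬? (x ∈? A)) B

∈-∪⁺ˡ : ∀ {A B x} → x ∈ A → x ∈ A ∪ B
∈-∪⁺ˡ = ∈-++⁺ˡ

∈-∪⁺ʳ : ∀ {A B x} → x ∈ B → x ∈ A ∪ B
∈-∪⁺ʳ {A} {B} {x} x∈B with x ∈? A
... | yes x∈A = ∈-++⁺ˡ x∈A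
... | no x∉A = ∈-++⁺ʳ A (∈-filter⁺ (λ x → ¬? (x ∈? A)) x∈B x∉A)

∈-∪⁻ : ∀ {A B x} → x ∈ A ∪ B → x ∈ A ⊎ x ∈ B
∈-∪⁻ {A} {B} x∈ with ∈-++⁻ A x∈
... | inj₁ x∈A = inj₁ x∈A
... | inj₂ x∈B∖A = inj₂ (proj₁ (∈-filter⁻ (λ x → ¬? (x ∈? A)) {xs = B} x∈B∖A))

unique-∪ : ∀ {A B} → Unique A → Unique B → Unique (A ∪ B)
unique-∪ {A} {B} A! B! = Unique.++⁺ A! (Unique.filter⁺ (λ x → ¬? (x ∈? A)) B!)
  (λ (x∈A , x∈B∖A) → proj₂ (∈-filter⁻ (λ x → ¬? (x ∈? A)) {xs = B} x∈B∖A) x∈A)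

length-∪≥ʳ : ∀ {A B} → Unique B → length B ≤ length (A ∪ B)
length-∪≥ʳ {A} {B} B! = unique-⊆⇒length≤ B! (∈-∪⁺ʳ {A} {B})

sum-map-≤ : ∀ (f : ℕ → ℕ) m A xs → (∀ {x} → x ∈ xs → m * f x ≤ A) → m * sum (map f xs) ≤ length xs * A
sum-map-≤ f m A [] _ = ≤-reflexive (*-zeroʳ m)
sum-map-≤ f m A (x ∷ xs) bound = begin
  m * (f x + sum (map f xs))     ≡⟨ *-distribˡ-+ m (f x) _ ⟩
  m * f x + m * sum (map f xs)   ≤⟨ +-mono-≤ (bound (here refl)) (sum-map-≤ f m A xs (bound ∘ there)) ⟩
  A + length xs * A              ∎
  where open ≤-Reasoning

Eventually : (ℕ → Set) → Set
Eventually P = ∃ λ N → ∀ n → N ≤ n → P n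

eventually-∀∈ : ∀ (P : ℕ → ℕ → Set) xs → (∀ x → Eventually (P x)) → Eventually (λ n → ∀ {x} → x ∈ xs → P x n)
eventually-∀∈ P [] _ = 0 , λ _ _ ()
eventually-∀∈ P (x ∷ xs) ev with ev x | eventually-∀∈ P xs ev
... | N₁ , f₁ | N₂ , f₂ = N₁ ⊔ N₂ , λ where
  n N≤n (here refl) → f₁ n (≤-trans (m≤m⊔n N₁ N₂) N≤n)
  n N≤n (there x∈xs) → f₂ n (≤-trans (m≤n⊔m N₁ N₂) N≤n) x∈xs

n<2^n : ∀ n → n < 2 ^ n
n<2^n zero = s≤s z≤n
n<2^n (suc n) = begin-strict
  suc n          ≡⟨ +-comm 1 n ⟩
  n + 1          <⟨ +-mono-<-≤ (n<2^n n) (m^n>0 2 n) ⟩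
  2 ^ n + 2 ^ n  ≡⟨ cong (2 ^ n +_) (+-identityʳ (2 ^ n)) ⟨
  2 ^ suc n      ∎
  where open ≤-Reasoning

module Boundary (Γ : CountableGroup) where

  infixl 7 _·_
  _·_ : ℕ → ℕ → ℕ
  _·_ = _∙_ Γ

  e : ℕ
  e = ε Γ

  inv : ℕ → ℕ
  inv = _⁻¹ Γ

  group : Group 0ℓ 0ℓ
  group = record { Carrier = ℕ ; _≈_ = _≡_ ; _∙_ = _·_ ; ε = e ; _⁻¹ = inv ; isGroup = isGroup Γ }

  open Group group public using (assoc; identityˡ; inverseʳ)
  open GroupProperties group public using (\\-leftDividesˡ; \\-leftDividesʳ; ∙-cancelˡ; ∙-cancelʳ; ⁻¹-involutive)

  boundary : ℕ → FinSet → ℕ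
  boundary γ X = length (filter (λ x → ¬? ((γ · x) ∈? X)) X)

  boundary≤length : ∀ γ X → boundary γ X ≤ length X
  boundary≤length γ X = length-filter (λ x → ¬? ((γ · x) ∈? X)) X

  boundary≡0⇒closed : ∀ {γ X x} → boundary γ X ≡ 0 → x ∈ X → γ · x ∈ X
  boundary≡0⇒closed {γ} {X} {x} zero-boundary x∈X with (γ · x) ∈? X
  ... | yes γx∈X = γx∈X
  ... | no γx∉X = ⊥-elim (length-filter≡0⇒¬ (λ x → ¬? ((γ · x) ∈? X)) zero-boundary x∈X γx∉X)

  symDiffCard≡boundary+boundary⁻¹ : ∀ γ X → symDiffCard Γ γ X ≡ boundary γ X + boundary (inv γ) X
  symDiffCard≡boundary+boundary⁻¹ γ X = cong₂ _+_
    (length-filter-map (λ x → ¬? (x ∈? X)) (γ ·_) X)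
    (length-filter-cong (λ x → ¬? (x ∈? γX)) (λ x → ¬? ((inv γ · x) ∈? X)) X
      (λ _ x∉γX γ⁻¹x∈X → x∉γX (subst (_∈ γX) (\\-leftDividesˡ γ _) (∈-map⁺ (γ ·_) γ⁻¹x∈X)))
      (λ _ γ⁻¹x∉X x∈γX → γ⁻¹x∉X (let (y , y∈X , x≡γy) = ∈-map⁻ (γ ·_) x∈γX in
                                   subst (_∈ X) (sym (trans (cong (inv γ ·_) x≡γy) (\\-leftDividesʳ γ y))) y∈X)))
    where γX = translate Γ γ X

  boundary-ε : ∀ X → boundary e X ≡ 0
  boundary-ε X = ¬⇒length-filter≡0 (λ x → ¬? ((e · x) ∈? X)) X
    (λ x∈X ex∉X → ex∉X (subst (_∈ X) (sym (identityˡ _)) x∈X))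

  boundary-∙ : ∀ γ δ {X} → Unique X → boundary (γ · δ) X ≤ boundary γ X + boundary δ X
  boundary-∙ γ δ {X} X! = begin
    boundary (γ · δ) X                                ≡⟨ length-filter-split exits? δ-stays? X ⟩
    length (filter exits? (filter δ-stays? X))
      + length (filter exits? (filter (¬? ∘ δ-stays?) X)) ≤⟨ +-mono-≤ exits-after-δ (length-filter exits? (filter (¬? ∘ δ-stays?) X)) ⟩
    boundary γ X + boundary δ X                       ∎
    where
    open ≤-Reasoning
    exits? = λ x → ¬? ((γ · δ · x) ∈? X)
    δ-stays? = λ x → (δ · x) ∈? X
    γ-exits? = λ y → ¬? ((γ · y) ∈? X)
    L = filter exits? (filter δ-stays? X)
    L! : Unique L
    L! = Unique.filter⁺ exits? (Unique.filter⁺ δ-stays? X!)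
    δL⊆γ-exits : map (δ ·_) L ⊆ filter γ-exits? X
    δL⊆γ-exits y∈δL with ∈-map⁻ (δ ·_) y∈δL
    ... | x , x∈L , refl with ∈-filter⁻ exits? {xs = filter δ-stays? X} x∈L
    ... | x∈ , γδx∉X = ∈-filter⁺ γ-exits? (proj₂ (∈-filter⁻ δ-stays? {xs = X} x∈))
                         (γδx∉X ∘ subst (_∈ X) (sym (assoc γ δ x)))
    exits-after-δ : length L ≤ boundary γ X
    exits-after-δ = subst (_≤ boundary γ X) (length-map (δ ·_) L)
      (unique-⊆⇒length≤ (Unique.map⁺ (∙-cancelˡ δ _ _) L!) δL⊆γ-exits)

  boundary-∪ : ∀ γ A B → boundary γ (A ∪ B) ≤ boundary γ A + boundary γ B
  boundary-∪ γ A B = begin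
    boundary γ (A ∪ B)                                   ≡⟨ cong length (filter-++ exits? A B∖A) ⟩
    length (filter exits? A ++ filter exits? B∖A)        ≡⟨ length-++ (filter exits? A) ⟩
    length (filter exits? A) + length (filter exits? B∖A) ≤⟨ +-mono-≤ exits-A exits-B∖A ⟩
    boundary γ A + boundary γ B                          ∎
    where
    open ≤-Reasoning
    ∉A? = λ x → ¬? (x ∈? A)
    B∖A = filter ∉A? B
    exits? = λ x → ¬? ((γ · x) ∈? (A ∪ B))
    exits-A : length (filter exits? A) ≤ boundary γ A
    exits-A = length-filter-mono exits? (λ x → ¬? ((γ · x) ∈? A)) A
      (λ _ γx∉A∪B γx∈A → γx∉A∪B (∈-∪⁺ˡ {A} {B} γx∈A))
    exits-B∖A : length (filter exits? B∖A) ≤ boundary γ B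
    exits-B∖A = begin
      length (filter exits? B∖A)                          ≤⟨ m≤m+n _ _ ⟩
      length (filter exits? B∖A) + length (filter exits? (filter (¬? ∘ ∉A?) B))
                                                          ≡⟨ length-filter-split exits? ∉A? B ⟨
      length (filter exits? B)                            ≤⟨ length-filter-mono exits? (λ x → ¬? ((γ · x) ∈? B)) B
                                                               (λ _ γx∉A∪B γx∈B → γx∉A∪B (∈-∪⁺ʳ {A} {B} γx∈B)) ⟩
      boundary γ B                                        ∎

  symDiffCard-∪ : ∀ γ A B → symDiffCard Γ γ (A ∪ B) ≤ length A + length A + symDiffCard Γ γ B
  symDiffCard-∪ γ A B = begin
    symDiffCard Γ γ (A ∪ B)                                ≡⟨ symDiffCard≡boundary+boundary⁻¹ γ (A ∪ B) ⟩
    boundary γ (A ∪ B) + boundary (inv γ) (A ∪ B)          ≤⟨ +-mono-≤ (boundary-∪ γ A B) (boundary-∪ (inv γ) A B) ⟩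
    (boundary γ A + boundary γ B) + (boundary (inv γ) A + boundary (inv γ) B)
                                                           ≡⟨ +-interchange (boundary γ A) _ _ _ ⟩
    (boundary γ A + boundary (inv γ) A) + (boundary γ B + boundary (inv γ) B)
                                                           ≤⟨ +-monoˡ-≤ _ (+-mono-≤ (boundary≤length γ A) (boundary≤length (inv γ) A)) ⟩
    length A + length A + (boundary γ B + boundary (inv γ) B) ≡⟨ cong (length A + length A +_) (symDiffCard≡boundary+boundary⁻¹ γ B) ⟨
    length A + length A + symDiffCard Γ γ B                ∎
    where open ≤-Reasoning

  boundary-rightTranslate : ∀ γ g X → boundary γ (map (_· g) X) ≡ boundary γ X
  boundary-rightTranslate γ g X = trans
    (length-filter-map (λ y → ¬? ((γ · y) ∈? Xg)) (_· g) X)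
    (length-filter-cong (λ x → ¬? ((γ · (x · g)) ∈? Xg)) (λ x → ¬? ((γ · x) ∈? X)) X
      (λ _ γxg∉Xg γx∈X → γxg∉Xg (subst (_∈ Xg) (assoc γ _ g) (∈-map⁺ (_· g) γx∈X)))
      (λ {x} _ γx∉X γxg∈Xg → γx∉X (let (y , y∈X , γxg≡yg) = ∈-map⁻ (_· g) γxg∈Xg in
                                    subst (_∈ X) (sym (∙-cancelʳ g _ _ (trans (assoc γ x g) γxg≡yg))) y∈X)))
    where Xg = map (_· g) X

  totalBoundary : List ℕ → FinSet → ℕ
  totalBoundary G X = sum (map (λ g → boundary g X) G)

  totalBoundary-++ : ∀ A B X → totalBoundary (A ++ B) X ≡ totalBoundary A X + totalBoundary B X
  totalBoundary-++ A B X = trans (cong sum (map-++ (λ g → boundary g X) A B)) (sum-++ (map (λ g → boundary g X) A) _)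

  symDiffCard-rightTranslate : ∀ γ g X → symDiffCard Γ γ (map (_· g) X) ≡ symDiffCard Γ γ X
  symDiffCard-rightTranslate γ g X = begin
    symDiffCard Γ γ (map (_· g) X)                             ≡⟨ symDiffCard≡boundary+boundary⁻¹ γ (map (_· g) X) ⟩
    boundary γ (map (_· g) X) + boundary (inv γ) (map (_· g) X) ≡⟨ cong₂ _+_ (boundary-rightTranslate γ g X)
                                                                     (boundary-rightTranslate (inv γ) g X) ⟩
    boundary γ X + boundary (inv γ) X                           ≡⟨ symDiffCard≡boundary+boundary⁻¹ γ X ⟨
    symDiffCard Γ γ X                                           ∎
    where open ≡-Reasoning

  boundary-upTo≡0⇒length≥ : ∀ m {X x} → x ∈ X → (∀ {t} → t < m → boundary t X ≡ 0) → m ≤ length X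
  boundary-upTo≡0⇒length≥ m {X} {x} x∈X closed = begin
    m                             ≡⟨ trans (length-map (_· x) (upTo m)) (length-upTo m) ⟨
    length (map (_· x) (upTo m))  ≤⟨ unique-⊆⇒length≤ (Unique.map⁺ (∙-cancelʳ x _ _) (Unique.upTo⁺ m)) orbit⊆X ⟩
    length X                      ∎
    where
    open ≤-Reasoning
    orbit⊆X : map (_· x) (upTo m) ⊆ X
    orbit⊆X tx∈ with ∈-map⁻ (_· x) tx∈
    ... | t , t∈upTo , refl = boundary≡0⇒closed (closed (∈-upTo⁻ t∈upTo)) x∈X

  letters : ∀ {S x} → Generated Γ S x → List ℕ
  letters gen-ε = []
  letters (gen-s {s} _ w) = s ∷ letters w
  letters (gen-inv {s} _ w) = inv s ∷ letters w

  boundary≤totalBoundary-letters : ∀ {S X} → Unique X → ∀ {x} (w : Generated Γ S x) →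
    boundary x X ≤ totalBoundary (letters w) X
  boundary≤totalBoundary-letters {X = X} X! gen-ε = ≤-reflexive (boundary-ε X)
  boundary≤totalBoundary-letters {X = X} X! (gen-s {s} _ w) =
    ≤-trans (boundary-∙ s _ X!) (+-monoʳ-≤ (boundary s X) (boundary≤totalBoundary-letters X! w))
  boundary≤totalBoundary-letters {X = X} X! (gen-inv {s} _ w) =
    ≤-trans (boundary-∙ (inv s) _ X!) (+-monoʳ-≤ (boundary (inv s) X) (boundary≤totalBoundary-letters X! w))

module CayleyPaths (Γ : CountableGroup) (S : ℕ → Set) where
  open Boundary Γ

  S± : ℕ → Set
  S± g = S g ⊎ S (inv g)

  S±-inv : ∀ {g} → S± g → S± (inv g)
  S±-inv (inj₁ s) = inj₂ (subst S (sym (⁻¹-involutive _)) s)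
  S±-inv (inj₂ s) = inj₁ s

  letters-S± : ∀ {x} (w : Generated Γ S x) {g} → g ∈ letters w → S± g
  letters-S± (gen-s s w) (here refl) = inj₁ s
  letters-S± (gen-s s w) (there g∈w) = letters-S± w g∈w
  letters-S± (gen-inv s w) (here refl) = S±-inv (inj₁ s)
  letters-S± (gen-inv s w) (there g∈w) = letters-S± w g∈w

  CayAdj-sym : ∀ {x y} → CayAdj Γ S x y → CayAdj Γ S y x
  CayAdj-sym (γ , γ∈S± , refl , γx≢x) = inv γ , S±-inv γ∈S± , sym (\\-leftDividesʳ γ _) , γx≢x ∘ sym

  CayAdj-rightTranslate : ∀ g {x y} → CayAdj Γ S x y → CayAdj Γ S (x · g) (y · g)
  CayAdj-rightTranslate g {x} (γ , γ∈S± , refl , γx≢x) = γ , γ∈S± , assoc γ x g , γx≢x ∘ ∙-cancelʳ g _ _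

  PathIn-⊆ : ∀ {Φ Ψ} → Φ ⊆ Ψ → ∀ {x y} → PathIn Γ S Φ x y → PathIn Γ S Ψ x y
  PathIn-⊆ Φ⊆Ψ (here x∈Φ) = here (Φ⊆Ψ x∈Φ)
  PathIn-⊆ Φ⊆Ψ (step x∈Φ x~y p) = step (Φ⊆Ψ x∈Φ) x~y (PathIn-⊆ Φ⊆Ψ p)

  PathIn-snoc : ∀ {Φ x y z} → PathIn Γ S Φ x y → CayAdj Γ S y z → z ∈ Φ → PathIn Γ S Φ x z
  PathIn-snoc (here y∈Φ) y~z z∈Φ = step y∈Φ y~z (here z∈Φ)
  PathIn-snoc (step x∈Φ x~w p) y~z z∈Φ = step x∈Φ x~w (PathIn-snoc p y~z z∈Φ)

  PathIn-reverse : ∀ {Φ x y} → PathIn Γ S Φ x y → PathIn Γ S Φ y x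
  PathIn-reverse (here x∈Φ) = here x∈Φ
  PathIn-reverse (step x∈Φ x~w p) = PathIn-snoc (PathIn-reverse p) (CayAdj-sym x~w) x∈Φ

  PathIn-++ : ∀ {Φ x y z} → PathIn Γ S Φ x y → PathIn Γ S Φ y z → PathIn Γ S Φ x z
  PathIn-++ (here _) q = q
  PathIn-++ (step x∈Φ x~w p) q = step x∈Φ x~w (PathIn-++ p q)

  PathIn-rightTranslate : ∀ g {Φ x y} → PathIn Γ S Φ x y → PathIn Γ S (map (_· g) Φ) (x · g) (y · g)
  PathIn-rightTranslate g (here x∈Φ) = here (∈-map⁺ (_· g) x∈Φ)
  PathIn-rightTranslate g (step x∈Φ x~w p) =
    step (∈-map⁺ (_· g) x∈Φ) (CayAdj-rightTranslate g x~w) (PathIn-rightTranslate g p)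

  ConnectedTo : FinSet → ℕ → Set
  ConnectedTo Φ r = ∀ {x} → x ∈ Φ → PathIn Γ S Φ x r

  connectedTo⇒inducedConnected : ∀ {Φ r} → ConnectedTo Φ r → InducedConnected Γ S Φ
  connectedTo⇒inducedConnected Φ→r x∈Φ y∈Φ = PathIn-++ (Φ→r x∈Φ) (PathIn-reverse (Φ→r y∈Φ))

  connectedTo-rightTranslate : ∀ g {Φ r} → ConnectedTo Φ r → ConnectedTo (map (_· g) Φ) (r · g)
  connectedTo-rightTranslate g Φ→r xg∈Φg with ∈-map⁻ (_· g) xg∈Φg
  ... | x , x∈Φ , refl = PathIn-rightTranslate g (Φ→r x∈Φ)

  connectedTo-∪ : ∀ {A B r} → ConnectedTo A r → ConnectedTo B r → ConnectedTo (A ∪ B) r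
  connectedTo-∪ {A} {B} A→r B→r x∈A∪B with ∈-∪⁻ {A} {B} x∈A∪B
  ... | inj₁ x∈A = PathIn-⊆ (∈-∪⁺ˡ {A} {B}) (A→r x∈A)
  ... | inj₂ x∈B = PathIn-⊆ (∈-∪⁺ʳ {A} {B}) (B→r x∈B)

  connectedTo-addNeighbour : ∀ {A r y g} → ConnectedTo A r → y ∈ A → S± g → ConnectedTo (A ∪ (g · y ∷ [])) r
  connectedTo-addNeighbour {A} {r} {y} {g} A→r y∈A g∈S± x∈A∪gy with ∈-∪⁻ {A} {g · y ∷ []} x∈A∪gy
  ... | inj₁ x∈A = PathIn-⊆ (∈-∪⁺ˡ {A} {g · y ∷ []}) (A→r x∈A)
  ... | inj₂ (here refl) = gy→r ((g · y) ∈? A)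
    where
    A⊆A∪gy = ∈-∪⁺ˡ {A} {g · y ∷ []}
    gy→r : Dec (g · y ∈ A) → PathIn Γ S (A ∪ (g · y ∷ [])) (g · y) r
    gy→r (yes gy∈A) = PathIn-⊆ A⊆A∪gy (A→r gy∈A)
    gy→r (no gy∉A) = step x∈A∪gy (CayAdj-sym y~gy) (PathIn-⊆ A⊆A∪gy (A→r y∈A))
      where y~gy = g , g∈S± , refl , λ gy≡y → gy∉A (subst (_∈ A) (sym gy≡y) y∈A)

  trace : ∀ {x} → Generated Γ S x → FinSet
  trace gen-ε = e ∷ []
  trace (gen-s {s} {y} _ w) = trace w ∪ (s · y ∷ [])
  trace (gen-inv {s} {y} _ w) = trace w ∪ (inv s · y ∷ [])

  unique-trace : ∀ {x} (w : Generated Γ S x) → Unique (trace w)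
  unique-trace gen-ε = [] ∷ []
  unique-trace (gen-s _ w) = unique-∪ (unique-trace w) ([] ∷ [])
  unique-trace (gen-inv _ w) = unique-∪ (unique-trace w) ([] ∷ [])

  ∈-trace-end : ∀ {x} (w : Generated Γ S x) → x ∈ trace w
  ∈-trace-end gen-ε = here refl
  ∈-trace-end (gen-s _ w) = ∈-∪⁺ʳ {trace w} (here refl)
  ∈-trace-end (gen-inv _ w) = ∈-∪⁺ʳ {trace w} (here refl)

  ε∈trace : ∀ {x} (w : Generated Γ S x) → e ∈ trace w
  ε∈trace gen-ε = here refl
  ε∈trace (gen-s _ w) = ∈-∪⁺ˡ {trace w} (ε∈trace w)
  ε∈trace (gen-inv _ w) = ∈-∪⁺ˡ {trace w} (ε∈trace w)

  trace-connectedTo-ε : ∀ {x} (w : Generated Γ S x) → ConnectedTo (trace w) e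
  trace-connectedTo-ε gen-ε (here refl) = here (here refl)
  trace-connectedTo-ε (gen-s s w) = connectedTo-addNeighbour (trace-connectedTo-ε w) (∈-trace-end w) (inj₁ s)
  trace-connectedTo-ε (gen-inv s w) = connectedTo-addNeighbour (trace-connectedTo-ε w) (∈-trace-end w) (S±-inv (inj₁ s))

module Components (Γ : CountableGroup) (S : ℕ → Set) (G : List ℕ)
                  (G⊆S± : ∀ {g} → g ∈ G → CayleyPaths.S± Γ S g)
                  (G-inv : ∀ {g} → g ∈ G → Boundary.inv Γ g ∈ G) where
  open Boundary Γ
  open CayleyPaths Γ S

  record Component (F : FinSet) (r : ℕ) : Set where
    field
      C : FinSet
      C! : Unique C
      C⊆F : C ⊆ F
      r∈C : r ∈ C
      C→r : ConnectedTo C r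
      closed : ∀ {c g} → c ∈ C → g ∈ G → g · c ∈ F → g · c ∈ C

  grow : ∀ F r fuel C → Unique C → C ⊆ F → r ∈ C → ConnectedTo C r → length F < length C + fuel → Component F r
  grow F r zero C C! C⊆F r∈C C→r F<C =
    contradiction (unique-⊆⇒length≤ C! C⊆F) (<⇒≱ (subst (length F <_) (+-identityʳ _) F<C))
  grow F r (suc fuel) C C! C⊆F r∈C C→r F<C+fuel
    with any? (λ c → any? (λ g → ((g · c) ∈? F) ×-dec ¬? ((g · c) ∈? C)) G) C
  ... | no noExit = record { C = C ; C! = C! ; C⊆F = C⊆F ; r∈C = r∈C ; C→r = C→r ; closed = closed }
    where
    closed : ∀ {c g} → c ∈ C → g ∈ G → g · c ∈ F → g · c ∈ C
    closed {c} {g} c∈C g∈G gc∈F with (g · c) ∈? C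
    ... | yes gc∈C = gc∈C
    ... | no gc∉C = ⊥-elim (noExit (lose c∈C (lose g∈G (gc∈F , gc∉C))))
  ... | yes exit with find exit
  ... | c , c∈C , exitAt-c with find exitAt-c
  ... | g , g∈G , gc∈F , gc∉C =
    grow F r fuel C' (unique-∪ C! ([] ∷ [])) C'⊆F (∈-∪⁺ˡ {C} r∈C) (connectedTo-addNeighbour C→r c∈C (G⊆S± g∈G))
      (≤-trans F<C+fuel (≤-trans (≤-reflexive (+-suc (length C) fuel)) (+-monoˡ-≤ fuel C<C')))
    where
    C' = C ∪ (g · c ∷ [])
    C'⊆F : C' ⊆ F
    C'⊆F x∈C' with ∈-∪⁻ {C} x∈C'
    ... | inj₁ x∈C = C⊆F x∈C
    ... | inj₂ (here refl) = gc∈F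
    C<C' : length C < length C'
    C<C' = unique-⊆⇒length≤ {g · c ∷ C} (All.tabulate (λ { x∈C refl → gc∉C x∈C }) ∷ C!)
      (λ { (here refl) → ∈-∪⁺ʳ {C} (here refl) ; (there x∈C) → ∈-∪⁺ˡ {C} x∈C })

  component : ∀ F r → r ∈ F → Component F r
  component F r r∈F = grow F r (length F) (r ∷ []) ([] ∷ []) (λ { (here refl) → r∈F }) (here refl)
    (λ { (here refl) → here (here refl) }) ≤-refl

  module Split {F r} (F! : Unique F) (K : Component F r) where
    open Component K public

    ∉C? : Decidable (_∉ C)
    ∉C? x = ¬? (x ∈? C)

    rest : FinSet
    rest = filter ∉C? F

    rest! : Unique rest
    rest! = Unique.filter⁺ ∉C? F!

    rest⊆F : rest ⊆ F
    rest⊆F x∈rest = proj₁ (∈-filter⁻ ∉C? {xs = F} x∈rest)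

    C≡F∩C : length (filter (_∈? C) F) ≡ length C
    C≡F∩C = ≤-antisym
      (unique-⊆⇒length≤ (Unique.filter⁺ (_∈? C) F!) (λ x∈ → proj₂ (∈-filter⁻ (_∈? C) {xs = F} x∈)))
      (unique-⊆⇒length≤ C! (λ x∈C → ∈-filter⁺ (_∈? C) (C⊆F x∈C) x∈C))

    length-split : length F ≡ length C + length rest
    length-split = trans (sym (length-filter+length-filter-¬ (_∈? C) F)) (cong (_+ length rest) C≡F∩C)

    -- rest is G-closed in F as well, because G is closed under inverses.
    rest-closed : ∀ {x g} → x ∈ rest → g ∈ G → g · x ∈ F → g · x ∈ rest
    rest-closed {x} {g} x∈rest g∈G gx∈F with (g · x) ∈? C
    ... | no gx∉C = ∈-filter⁺ ∉C? gx∈F gx∉C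
    ... | yes gx∈C = ⊥-elim (proj₂ (∈-filter⁻ ∉C? {xs = F} x∈rest)
            (subst (_∈ C) (\\-leftDividesʳ g x)
              (closed gx∈C (G-inv g∈G) (subst (_∈ F) (sym (\\-leftDividesʳ g x)) (rest⊆F x∈rest)))))

    boundary-split : ∀ {g} → g ∈ G → boundary g F ≡ boundary g C + boundary g rest
    boundary-split {g} g∈G = trans (length-filter-split exitsF? (_∈? C) F) (cong₂ _+_ exits-C exits-rest)
      where
      exitsF? = λ x → ¬? ((g · x) ∈? F)
      exits-C : length (filter exitsF? (filter (_∈? C) F)) ≡ boundary g C
      exits-C = trans
        (length-filter-⊆⊇ exitsF? (Unique.filter⁺ (_∈? C) F!) C!
           (λ x∈ → proj₂ (∈-filter⁻ (_∈? C) {xs = F} x∈)) (λ x∈C → ∈-filter⁺ (_∈? C) (C⊆F x∈C) x∈C))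
        (length-filter-cong exitsF? (λ x → ¬? ((g · x) ∈? C)) C
           (λ _ gx∉F gx∈C → gx∉F (C⊆F gx∈C)) (λ x∈C gx∉C gx∈F → gx∉C (closed x∈C g∈G gx∈F)))
      exits-rest : length (filter exitsF? rest) ≡ boundary g rest
      exits-rest = length-filter-cong exitsF? (λ x → ¬? ((g · x) ∈? rest)) rest
        (λ _ gx∉F gx∈rest → gx∉F (rest⊆F gx∈rest)) (λ x∈ gx∉rest gx∈F → gx∉rest (rest-closed x∈ g∈G gx∈F))

    totalBoundary-split : ∀ G' → G' ⊆ G → totalBoundary G' F ≡ totalBoundary G' C + totalBoundary G' rest
    totalBoundary-split [] _ = refl
    totalBoundary-split (g ∷ G') G'⊆G = trans
      (cong₂ _+_ (boundary-split (G'⊆G (here refl))) (totalBoundary-split G' (G'⊆G ∘ there)))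
      (+-interchange (boundary g C) (boundary g rest) (totalBoundary G' C) (totalBoundary G' rest))

  record ConnectedPiece (R : ℕ) : Set where
    field
      piece : FinSet
      piece! : Unique piece
      root : ℕ
      root∈piece : root ∈ piece
      piece→root : ConnectedTo piece root
      thin : R * totalBoundary G piece ≤ length piece

  -- If every component of F had a thick boundary, then, the boundary being additive
  -- over components, so would F.
  connectedPiece : ∀ R fuel F → Unique F → length F ≤ fuel → 0 < length F →
    R * totalBoundary G F ≤ length F → ConnectedPiece R
  connectedPiece R zero F _ F≤0 F>0 _ = contradiction F≤0 (<⇒≱ F>0)
  connectedPiece R (suc fuel) (x ∷ F₀) F! F≤fuel _ F-thin = byThinness (R * totalBoundary G C ≤? length C)
    where
    F = x ∷ F₀
    open Split F! (component F x (here refl))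
    byThinness : Dec (R * totalBoundary G C ≤ length C) → ConnectedPiece R
    byThinness (yes C-thin) = record
      { piece = C ; piece! = C! ; root = x ; root∈piece = r∈C ; piece→root = C→r ; thin = C-thin }
    byThinness (no C-thick) = connectedPiece R fuel rest rest! rest≤fuel (≤-<-trans z≤n rest-thin) (<⇒≤ rest-thin)
      where
      open ≤-Reasoning
      rest-thin : R * totalBoundary G rest < length rest
      rest-thin = ≰⇒> λ rest≤ → <⇒≱ (+-mono-<-≤ (≰⇒> C-thick) rest≤) (begin
        R * totalBoundary G C + R * totalBoundary G rest ≡⟨ *-distribˡ-+ R _ _ ⟨
        R * (totalBoundary G C + totalBoundary G rest)  ≡⟨ cong (R *_) (totalBoundary-split G (λ g∈G → g∈G)) ⟨
        R * totalBoundary G F                           ≤⟨ F-thin ⟩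
        length F                                        ≡⟨ length-split ⟩
        length C + length rest                          ∎)
      rest≤fuel : length rest ≤ fuel
      rest≤fuel = ≤-pred (begin
        1 + length rest        ≤⟨ +-monoˡ-≤ (length rest) (∈-length r∈C) ⟩
        length C + length rest ≡⟨ length-split ⟨
        length F               ≤⟨ F≤fuel ⟩
        suc fuel               ∎)

module ConnectedFolnerSets (Γ : CountableGroup) (S : ℕ → Set) (gen : Generates Γ S)
                           (Φ : ℕ → FinSet) (Φ-folner : IsFolner Γ Φ) where
  open Boundary Γ
  open CayleyPaths Γ S

  wordLetters : ℕ → List ℕ
  wordLetters γ = letters (gen γ) ++ letters (gen (inv γ))

  letterList : List ℕ → List ℕ
  letterList [] = []
  letterList (γ ∷ T) = wordLetters γ ++ letterList T

  generatorList : List ℕ → List ℕ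
  generatorList T = letterList T ++ map inv (letterList T)

  letterList-S± : ∀ T {g} → g ∈ letterList T → S± g
  letterList-S± (γ ∷ T) g∈ with ∈-++⁻ (wordLetters γ) g∈
  ... | inj₂ g∈T = letterList-S± T g∈T
  ... | inj₁ g∈γ±1 with ∈-++⁻ (letters (gen γ)) g∈γ±1
  ...   | inj₁ g∈γ = letters-S± (gen γ) g∈γ
  ...   | inj₂ g∈γ⁻¹ = letters-S± (gen (inv γ)) g∈γ⁻¹

  generatorList-S± : ∀ T {g} → g ∈ generatorList T → S± g
  generatorList-S± T g∈ with ∈-++⁻ (letterList T) g∈
  ... | inj₁ g∈L = letterList-S± T g∈L
  ... | inj₂ g∈L⁻¹ with ∈-map⁻ inv g∈L⁻¹
  ...   | h , h∈L , refl = S±-inv (letterList-S± T h∈L)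

  generatorList-inv : ∀ T {g} → g ∈ generatorList T → inv g ∈ generatorList T
  generatorList-inv T g∈ with ∈-++⁻ (letterList T) g∈
  ... | inj₁ g∈L = ∈-++⁺ʳ (letterList T) (∈-map⁺ inv g∈L)
  ... | inj₂ g∈L⁻¹ with ∈-map⁻ inv g∈L⁻¹
  ...   | h , h∈L , refl = ∈-++⁺ˡ (subst (_∈ letterList T) (sym (⁻¹-involutive h)) h∈L)

  symDiffCard≤totalBoundary-wordLetters : ∀ γ {X} → Unique X → symDiffCard Γ γ X ≤ totalBoundary (wordLetters γ) X
  symDiffCard≤totalBoundary-wordLetters γ {X} X! = begin
    symDiffCard Γ γ X                    ≡⟨ symDiffCard≡boundary+boundary⁻¹ γ X ⟩
    boundary γ X + boundary (inv γ) X    ≤⟨ +-mono-≤ (boundary≤totalBoundary-letters X! (gen γ))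
                                                      (boundary≤totalBoundary-letters X! (gen (inv γ))) ⟩
    totalBoundary (letters (gen γ)) X + totalBoundary (letters (gen (inv γ))) X
                                         ≡⟨ totalBoundary-++ (letters (gen γ)) _ X ⟨
    totalBoundary (wordLetters γ) X      ∎
    where open ≤-Reasoning

  totalBoundary-wordLetters≤letterList : ∀ {γ T} X → γ ∈ T → totalBoundary (wordLetters γ) X ≤ totalBoundary (letterList T) X
  totalBoundary-wordLetters≤letterList {γ} {γ ∷ T} X (here refl) =
    ≤-trans (m≤m+n _ _) (≤-reflexive (sym (totalBoundary-++ (wordLetters γ) (letterList T) X)))
  totalBoundary-wordLetters≤letterList {γ} {δ ∷ T} X (there γ∈T) =
    ≤-trans (totalBoundary-wordLetters≤letterList X γ∈T)
      (≤-trans (m≤n+m _ _) (≤-reflexive (sym (totalBoundary-++ (wordLetters δ) (letterList T) X))))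

  symDiffCard≤totalBoundary-generatorList : ∀ {γ T X} → Unique X → γ ∈ T →
    symDiffCard Γ γ X ≤ totalBoundary (generatorList T) X
  symDiffCard≤totalBoundary-generatorList {γ} {T} {X} X! γ∈T = begin
    symDiffCard Γ γ X                    ≤⟨ symDiffCard≤totalBoundary-wordLetters γ X! ⟩
    totalBoundary (wordLetters γ) X      ≤⟨ totalBoundary-wordLetters≤letterList X γ∈T ⟩
    totalBoundary (letterList T) X       ≤⟨ m≤m+n _ _ ⟩
    totalBoundary (letterList T) X + totalBoundary (map inv (letterList T)) X
                                         ≡⟨ totalBoundary-++ (letterList T) _ X ⟨
    totalBoundary (generatorList T) X    ∎
    where open ≤-Reasoning

  thinFolnerSet : ∀ G R → ∃ λ n → R * totalBoundary G (Φ n) ≤ length (Φ n)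
  thinFolnerSet [] R = 0 , ≤-trans (≤-reflexive (*-zeroʳ R)) z≤n
  thinFolnerSet G@(_ ∷ _) R with eventually-∀∈ AlmostInvariant G (λ g → proj₂ Φ-folner g (R * length G))
    where AlmostInvariant = λ g n → suc (R * length G) * symDiffCard Γ g (Φ n) ≤ length (Φ n)
  ... | N , almostInvariant = N , *-cancelˡ-≤ (length G) (begin
    length G * (R * totalBoundary G F)   ≡⟨ *-assoc (length G) R _ ⟨
    (length G * R) * totalBoundary G F   ≡⟨ cong (_* totalBoundary G F) (*-comm (length G) R) ⟩
    (R * length G) * totalBoundary G F   ≤⟨ sum-map-≤ (λ g → boundary g F) (R * length G) (length F) G each ⟩
    length G * length F                  ∎)
    where
    open ≤-Reasoning
    F = Φ N
    each : ∀ {g} → g ∈ G → R * length G * boundary g F ≤ length F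
    each {g} g∈G = begin
      R * length G * boundary g F                   ≤⟨ *-mono-≤ (n≤1+n (R * length G)) (m≤m+n (boundary g F) (boundary (inv g) F)) ⟩
      suc (R * length G) * (boundary g F + boundary (inv g) F)
                                                    ≡⟨ cong (suc (R * length G) *_) (symDiffCard≡boundary+boundary⁻¹ g F) ⟨
      suc (R * length G) * symDiffCard Γ g F        ≤⟨ almostInvariant N ≤-refl g∈G ⟩
      length F                                      ∎

  record ConnectedFolnerSet (T : List ℕ) (q m : ℕ) : Set where
    field
      set : FinSet
      set! : Unique set
      ε∈set : e ∈ set
      set→ε : ConnectedTo set e
      almostInvariant : ∀ {γ} → γ ∈ T → q * symDiffCard Γ γ set ≤ length set
      large : m ≤ length set

  -- Controlling upTo m as well gives the size bound: a piece with empty boundary is then invariant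
  -- under 0, …, m-1, and otherwise R = q + m ≥ m already bounds it.
  connectedFolnerSet : ∀ T q m → ConnectedFolnerSet T q m
  connectedFolnerSet T q m = record
    { set = map (_· inv root) piece
    ; set! = Unique.map⁺ (∙-cancelʳ (inv root) _ _) piece!
    ; ε∈set = subst (_∈ map (_· inv root) piece) (inverseʳ root) (∈-map⁺ (_· inv root) root∈piece)
    ; set→ε = subst (ConnectedTo (map (_· inv root) piece)) (inverseʳ root)
                (connectedTo-rightTranslate (inv root) piece→root)
    ; almostInvariant = λ {γ} γ∈T → subst₂ (λ a b → q * a ≤ b)
        (sym (symDiffCard-rightTranslate γ (inv root) piece)) (sym (length-map (_· inv root) piece))
        (piece-almostInvariant (∈-++⁺ˡ γ∈T))
    ; large = subst (m ≤_) (sym (length-map (_· inv root) piece)) (piece-large (totalBoundary G piece) refl)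
    }
    where
    T' = T ++ upTo m
    G = generatorList T'
    R = q + m
    open Components Γ S G (generatorList-S± T') (generatorList-inv T')
    n = proj₁ (thinFolnerSet G R)
    F = Φ n
    F-nonEmpty = proj₁ Φ-folner n
    open ConnectedPiece (connectedPiece R (length F) F (proj₁ F-nonEmpty) ≤-refl
                           (∈-length (proj₂ (proj₂ F-nonEmpty))) (proj₂ (thinFolnerSet G R)))

    sd≤∂ : ∀ {γ} → γ ∈ T' → symDiffCard Γ γ piece ≤ totalBoundary G piece
    sd≤∂ = symDiffCard≤totalBoundary-generatorList piece!

    piece-almostInvariant : ∀ {γ} → γ ∈ T' → q * symDiffCard Γ γ piece ≤ length piece
    piece-almostInvariant γ∈T' =
      ≤-trans (*-mono-≤ (m≤m+n q m) (sd≤∂ γ∈T')) thin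

    piece-large : ∀ b → totalBoundary G piece ≡ b → m ≤ length piece
    piece-large zero ∂≡0 = boundary-upTo≡0⇒length≥ m root∈piece λ {t} t<m → n≤0⇒n≡0 (begin
      boundary t piece                                ≤⟨ m≤m+n _ _ ⟩
      boundary t piece + boundary (inv t) piece       ≡⟨ symDiffCard≡boundary+boundary⁻¹ t piece ⟨
      symDiffCard Γ t piece                           ≤⟨ sd≤∂ (∈-++⁺ʳ T (∈-upTo⁺ t<m)) ⟩
      totalBoundary G piece                           ≡⟨ ∂≡0 ⟩
      0                                               ∎)
      where open ≤-Reasoning
    piece-large (suc b) ∂≡1+b = begin
      m                         ≤⟨ m≤n+m m q ⟩
      R                         ≤⟨ m≤m*n R (suc b) ⟩
      R * suc b                 ≡⟨ cong (R *_) ∂≡1+b ⟨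
      R * totalBoundary G piece ≤⟨ thin ⟩
      length piece              ∎
      where open ≤-Reasoning

module FolnerExhaustion (Γ : CountableGroup) (S : ℕ → Set) (gen : Generates Γ S)
                        (Φ : ℕ → FinSet) (Φ-folner : IsFolner Γ Φ) where
  open Boundary Γ
  open CayleyPaths Γ S
  open ConnectedFolnerSets Γ S gen Φ Φ-folner

  record RootedSet : Set where
    field
      set : FinSet
      set! : Unique set
      ε∈set : e ∈ set
      set→ε : ConnectedTo set e

  -- C is chosen with 2a · |γC △ C| ≤ |C| and 4a · |U| ≤ |C|, so that
  -- a · |γ(U ∪ C) △ (U ∪ C)| ≤ a · (2|U| + |γC △ C|) ≤ |C|; the term (n+1)² gives the growth.
  module Step (n : ℕ) (P : RootedSet) where
    open RootedSet P

    U : FinSet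
    U = set ∪ trace (gen n)

    U! : Unique U
    U! = unique-∪ set! (unique-trace (gen n))

    a : ℕ
    a = suc (suc n)

    K : ConnectedFolnerSet (upTo (suc n)) (2 * a) (suc (4 * a * length U + suc n * suc n))
    K = connectedFolnerSet _ _ _

    C : FinSet
    C = ConnectedFolnerSet.set K

    C! : Unique C
    C! = ConnectedFolnerSet.set! K

    next : RootedSet
    next = record
      { set = U ∪ C
      ; set! = unique-∪ U! C!
      ; ε∈set = ∈-∪⁺ˡ {U} {C} (∈-∪⁺ˡ {set} {trace (gen n)} ε∈set)
      ; set→ε = connectedTo-∪ {U} {C} (connectedTo-∪ {set} {trace (gen n)} set→ε (trace-connectedTo-ε (gen n)))
                  (ConnectedFolnerSet.set→ε K)
      }

    set⊆next : set ⊆ RootedSet.set next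
    set⊆next x∈set = ∈-∪⁺ˡ {U} {C} (∈-∪⁺ˡ {set} {trace (gen n)} x∈set)

    n∈next : n ∈ RootedSet.set next
    n∈next = ∈-∪⁺ˡ {U} {C} (∈-∪⁺ʳ {set} {trace (gen n)} (∈-trace-end (gen n)))

    C≤next : length C ≤ length (U ∪ C)
    C≤next = length-∪≥ʳ {U} {C} C!

    large : suc n * suc n ≤ length (U ∪ C)
    large = ≤-trans (≤-trans (m≤n+m _ _) (n≤1+n _)) (≤-trans (ConnectedFolnerSet.large K) C≤next)

    new : ∃ λ x → x ∈ RootedSet.set next × x ∉ set
    new with unique-length<⇒∃∉ {set} {C} C! set<C
      where
      set<C : length set < length C
      set<C = ≤-trans (s≤s (begin
        length set              ≤⟨ unique-⊆⇒length≤ set! (∈-∪⁺ˡ {set} {trace (gen n)}) ⟩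
        length U                ≤⟨ m≤n*m (length U) (4 * a) ⟩
        4 * a * length U        ≤⟨ m≤m+n _ _ ⟩
        4 * a * length U + suc n * suc n ∎)) (ConnectedFolnerSet.large K)
        where open ≤-Reasoning
    ... | x , x∈C , x∉set = x , ∈-∪⁺ʳ {U} {C} x∈C , x∉set

    almostInvariant : ∀ {γ} → γ ≤ n → a * symDiffCard Γ γ (U ∪ C) ≤ length (U ∪ C)
    almostInvariant {γ} γ≤n = ≤-trans (*-monoʳ-≤ a (symDiffCard-∪ γ U C)) (≤-trans halves C≤next)
      where
      u = length U
      s = symDiffCard Γ γ C
      C-large : 4 * a * u ≤ length C
      C-large = ≤-trans (≤-trans (m≤m+n _ _) (n≤1+n _)) (ConnectedFolnerSet.large K)
      C-almostInvariant : 2 * a * s ≤ length C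
      C-almostInvariant = ConnectedFolnerSet.almostInvariant K (∈-upTo⁺ (s≤s γ≤n))
      halves : a * (u + u + s) ≤ length C
      halves = *-cancelˡ-≤ 2 (begin
        2 * (a * (u + u + s))        ≡⟨ double-expand a u s ⟩
        4 * a * u + 2 * a * s      ≤⟨ +-mono-≤ C-large C-almostInvariant ⟩
        length C + length C          ≡⟨ cong (length C +_) (+-identityʳ (length C)) ⟨
        2 * length C                 ∎)
        where
        open ≤-Reasoning
        double-expand : ∀ a u s → 2 * (a * (u + u + s)) ≡ 4 * a * u + 2 * a * s
        double-expand = solve-∀

  stage : ℕ → RootedSet
  stage zero = record { set = e ∷ [] ; set! = [] ∷ [] ; ε∈set = here refl ; set→ε = λ { (here refl) → here (here refl) } }
  stage (suc n) = Step.next n (stage n)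

  Ψ : ℕ → FinSet
  Ψ n = RootedSet.set (stage n)

  Ψ-folner : IsFolner Γ Ψ
  Ψ-folner = (λ n → RootedSet.set! (stage n) , e , RootedSet.ε∈set (stage n))
           , λ γ k → suc (γ + k) , λ where
               (suc n) γ+k<1+n → ≤-trans
                 (*-monoˡ-≤ (symDiffCard Γ γ (Ψ (suc n))) (s≤s (m≤n⇒m≤1+n (≤-trans (m≤n+m k γ) (≤-pred γ+k<1+n)))))
                 (Step.almostInvariant n (stage n) (≤-trans (m≤m+n γ k) (≤-pred γ+k<1+n)))

  Ψ-connected : ∀ n → InducedConnected Γ S (Ψ n)
  Ψ-connected n = connectedTo⇒inducedConnected (RootedSet.set→ε (stage n))

  Ψ-strictlyIncreasing : ∀ n → Ψ n ⊂ Ψ (suc n)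
  Ψ-strictlyIncreasing n = Step.set⊆next n (stage n) , Step.new n (stage n)

  Ψ-exhaustive : ∀ x → ∃ λ n → x ∈ Ψ n
  Ψ-exhaustive x = suc x , Step.n∈next x (stage x)

  Ψ-growsFasterThanLog : GrowsFasterThanLog Ψ
  Ψ-growsFasterThanLog M = suc M , λ where (suc n) M<1+n → bound n (≤-pred M<1+n)
    where
    open ≤-Reasoning
    bound : ∀ n → M ≤ n → suc n ^ M ≤ 2 ^ length (Ψ (suc n))
    bound n M≤n = let k = suc n in begin
      k ^ M            ≤⟨ ^-monoˡ-≤ M (<⇒≤ (n<2^n k)) ⟩
      (2 ^ k) ^ M      ≡⟨ ^-*-assoc 2 k M ⟩
      2 ^ (k * M)      ≤⟨ ^-monoʳ-≤ 2 (*-monoʳ-≤ k (m≤n⇒m≤1+n M≤n)) ⟩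
      2 ^ (k * k)      ≤⟨ ^-monoʳ-≤ 2 (Step.large n (stage n)) ⟩
      2 ^ length (Ψ k) ∎

corollary7p3 : (Γ : CountableGroup) → (S : ℕ → Set) → Amenable Γ → Generates Γ S →
    ∃ λ Φ → IsFolner Γ Φ
      × ((n : ℕ) → InducedConnected Γ S (Φ n))
      × (ε Γ ∈ Φ 0)
      × ((n : ℕ) → Φ n ⊂ Φ (suc n))
      × ((x : ℕ) → ∃ λ n → x ∈ Φ n)
      × GrowsFasterThanLog Φ
corollary7p3 Γ S (Φ , Φ-folner) gen =
  Ψ , Ψ-folner , Ψ-connected , here refl , Ψ-strictlyIncreasing , Ψ-exhaustive , Ψ-growsFasterThanLog
  where open FolnerExhaustion Γ S gen Φ Φ-folner
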